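{- Let $p$ be an odd prime and $x\in\mathbf Z/p\setminus\{0,1,1/2\}$; put $y=x-1$. In the multiplicative group $G=1+\lambda\,\mathbf Z/p[\lambda]$ (with $\lambda^{p-1}=0$), let $w=x-y(1-\lambda)$, $\sigma(w)=x-y(1-\lambda)^{ -1}$ and $z'(x)=w\,\sigma(w)^{ -1}$. Then $z'(x)$ is not collinear with $1-\lambda$, i.e. $z'(x)\notin\{(1-\lambda)^k:k\in\mathbf Z\}$.
   Context: $\mathbf Z/p[\lambda]$ with $\lambda^{p-1}=0$ is the ring $\mathbf Z[\zeta_p]/p$, $\lambda$ being the image of $1-\zeta_p$. The group $G$ of units congruent to $1$ mod $\lambda$ is isomorphic to $K_1(\mathbf Z[\zeta_p]/p;\mathbf Z/p)$ and is a $\mathbf Z/p$-vector space (written multiplicatively). Note $w=1+y\lambda\in G$ and $\sigma(w)\in G$. -}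

module Defs where

open import Data.Nat as ℕ using (ℕ; zero; suc; _∸_; _<_)
open import Data.Integer as ℤ using (ℤ; +_; -[1+_]; _+_; _-_; _*_; -_)
open import Data.Integer.Divisibility as ℤD using ()

-- Truncated polynomial ring  (Z/p)[λ]/(λ^(p-1)) = Z[ζ_p]/p.
-- An element is represented by its coefficient sequence ℕ → ℤ
-- (coefficient of λ^i); two representatives are equal in the ring
-- iff their coefficients of λ^i agree mod p for every i < p-1.
Poly : Set
Poly = ℕ → ℤ

_≈[_]_ : Poly → ℕ → Poly → Set
a ≈[ p ] b = ∀ i → i < p ∸ 1 → (+ p) ℤD.∣ (a i - b i)

sumTo : (ℕ → ℤ) → ℕ → ℤ
sumTo f zero = + 0
sumTo f (suc n) = sumTo f n + f n

const : ℤ → Poly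
const c zero = c
const c (suc _) = + 0

𝟘 𝟙 : Poly
𝟘 = const (+ 0)
𝟙 = const (+ 1)

lam : Poly
lam (suc zero) = + 1
lam _ = + 0

_⊕_ : Poly → Poly → Poly
(a ⊕ b) i = a i + b i

_⊖_ : Poly → Poly → Poly
(a ⊖ b) i = a i - b i

_⊗_ : Poly → Poly → Poly
(a ⊗ b) i = sumTo (λ j → a j * b (i ∸ j)) (suc i)

infixl 6 _⊕_ _⊖_
infix 4 _≈[_]_
infixl 7 _⊗_

_^_ : Poly → ℕ → Poly
a ^ zero = 𝟙
a ^ suc n = a ⊗ (a ^ n)

oneMinusLam : Poly
oneMinusLam = 𝟙 ⊖ lam

-- integer powers of an element a, given an element ainv (intended to be
-- its inverse):  a^(+n) = a^n,  a^(-(n+1)) = ainv^(n+1)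
zpow : Poly → Poly → ℤ → Poly
zpow a ainv (+ n) = a ^ n
zpow a ainv -[1+ n ] = ainv ^ suc n

{-# OPTIONS --safe #-}
-- Modulo λ⁴ the powers (1 - λ)^k are truncated binomial series, so whatever k is their
-- coefficients satisfy 6 c₃ ≡ c₁ (c₁ + 1) (c₁ + 2) mod p.  Inverting 1 - λ and
-- σ(w) = 1 - yλ - yλ² - yλ³ modulo λ⁴ gives z'(x) ≡ 1 + 2yλ + y(2x - 1)λ² + xy(2x - 1)λ³,
-- for which that relation reads 6 xy(2x - 1) ≡ 4 xy(2x - 1), i.e. p ∣ 2x(x - 1)(2x - 1),
-- which the hypotheses on x exclude.  This needs λ³ ≠ 0, i.e. p ≥ 5; for p = 3 the
-- residues 0, 1, 1/2 exhaust ℤ/3, so no admissible x exists.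
module Submission where

open import Defs
open import Data.Nat using (ℕ)
open import Data.Nat.Primality using (Prime)
open import Data.Integer using (ℤ; +_; _-_; _*_)
open import Data.Integer.Divisibility using (_∣_)
open import Relation.Binary.PropositionalEquality using (_≢_)
open import Relation.Nullary using (¬_)

open import Data.Nat.Base using (zero; suc; _∸_; _≤_; _<_; z≤n; s≤s)
import Data.Nat.Properties as ℕ
open import Data.Nat.Divisibility using (∣⇒≤) renaming (_∣_ to _∣ℕ_)
open import Data.Nat.Primality using (prime?; euclidsLemma; ¬prime[0]; ¬prime[1])
open import Data.Integer.Base using (-[1+_]; -_; _+_; ∣_∣)
import Data.Integer.Properties as ℤ
import Data.Integer.Divisibility.Signed as Signed
open Signed using (divides; ∣ᵤ⇒∣; ∣⇒∣ᵤ; ∣m∣n⇒∣m+n; ∣m⇒∣-m; ∣n⇒∣m*n; ∣m⇒∣m*n)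
open import Data.Integer.DivMod using (_%_; _/_; a≡a%n+[a/n]*n; n%d<d)
open import Data.Integer.Tactic.RingSolver using (solve)
open import Data.List.Base using (_∷_; [])
open import Data.Sum.Base using (_⊎_; inj₁; inj₂; [_,_]′)
open import Data.Empty using (⊥-elim)
open import Level using (0ℓ)
open import Relation.Binary.Bundles using (Setoid)
open import Relation.Binary.PropositionalEquality
  using (_≡_; refl; sym; trans; cong; cong₂; subst; module ≡-Reasoning)
open import Relation.Nullary.Decidable using (toWitnessFalse)
open import Relation.Nullary.Negation using (contradiction)
open import Function.Base using (_∋_)

⊗-coeff₀ : ∀ a b → (a ⊗ b) 0 ≡ a 0 * b 0
⊗-coeff₀ a b = ℤ.+-identityˡ (a 0 * b 0)

⊗-coeff₁ : ∀ a b → (a ⊗ b) 1 ≡ a 0 * b 1 + a 1 * b 0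
⊗-coeff₁ a b = cong (_+ a 1 * b 0) (ℤ.+-identityˡ (a 0 * b 1))

⊗-coeff₂ : ∀ a b → (a ⊗ b) 2 ≡ a 0 * b 2 + a 1 * b 1 + a 2 * b 0
⊗-coeff₂ a b = cong (λ t → t + a 1 * b 1 + a 2 * b 0) (ℤ.+-identityˡ (a 0 * b 2))

⊗-coeff₃ : ∀ a b → (a ⊗ b) 3 ≡ a 0 * b 3 + a 1 * b 2 + a 2 * b 1 + a 3 * b 0
⊗-coeff₃ a b = cong (λ t → t + a 1 * b 2 + a 2 * b 1 + a 3 * b 0) (ℤ.+-identityˡ (a 0 * b 3))

sumTo-head : ∀ f → (∀ j → f (suc j) ≡ + 0) → ∀ n → sumTo f (suc n) ≡ f 0
sumTo-head f f[1+j]≡0 zero    = ℤ.+-identityˡ (f 0)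
sumTo-head f f[1+j]≡0 (suc n) = begin
  sumTo f (suc n) + f (suc n) ≡⟨ cong₂ _+_ (sumTo-head f f[1+j]≡0 n) (f[1+j]≡0 n) ⟩
  f 0 + + 0                   ≡⟨ ℤ.+-identityʳ (f 0) ⟩
  f 0                         ∎
  where open ≡-Reasoning

const-⊗ : ∀ c a i → (const c ⊗ a) i ≡ c * a i
const-⊗ c a i = sumTo-head (λ j → const c j * a (i ∸ j)) (λ _ → refl) i

jet : ℤ → ℤ → ℤ → ℤ → Poly
jet a₀ a₁ a₂ a₃ 0 = a₀
jet a₀ a₁ a₂ a₃ 1 = a₁
jet a₀ a₁ a₂ a₃ 2 = a₂
jet a₀ a₁ a₂ a₃ 3 = a₃
jet a₀ a₁ a₂ a₃ (suc (suc (suc (suc _)))) = + 0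

-- x - (x - 1) a, so that w = affine x (1 - λ) and σ(w) = affine x (1 - λ)⁻¹.
affine : ℤ → Poly → Poly
affine x a = const x ⊖ const (x - + 1) ⊗ a

module Modulo (p : ℕ) where

  infix 4 _≋_ _≈₄_

  -- A record rather than a synonym for  + p ∣ a - b,  so that a and b can be inferred.
  record _≋_ (a b : ℤ) : Set where
    constructor mod-p
    field p∣a-b : + p Signed.∣ a - b

  ∣⇒≋ : ∀ {a b e} → + p Signed.∣ e → a - b ≡ e → a ≋ b
  ∣⇒≋ p∣e a-b≡e = mod-p (subst (+ p Signed.∣_) (sym a-b≡e) p∣e)

  ≋-refl : ∀ {a} → a ≋ a
  ≋-refl {a} = ∣⇒≋ (divides (+ 0) refl) (ℤ.+-inverseʳ a)

  ≋-sym : ∀ {a b} → a ≋ b → b ≋ a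
  ≋-sym {a} {b} (mod-p p∣a-b) = ∣⇒≋ (∣m⇒∣-m p∣a-b) (solve (a ∷ b ∷ []))

  ≋-trans : ∀ {a b c} → a ≋ b → b ≋ c → a ≋ c
  ≋-trans {a} {b} {c} (mod-p p∣a-b) (mod-p p∣b-c) =
    ∣⇒≋ (∣m∣n⇒∣m+n p∣a-b p∣b-c) (solve (a ∷ b ∷ c ∷ []))

  ≡⇒≋ : ∀ {a b} → a ≡ b → a ≋ b
  ≡⇒≋ refl = ≋-refl

  +-cong : ∀ {a b c d} → a ≋ b → c ≋ d → a + c ≋ b + d
  +-cong {a} {b} {c} {d} (mod-p p∣a-b) (mod-p p∣c-d) =
    ∣⇒≋ (∣m∣n⇒∣m+n p∣a-b p∣c-d) (solve (a ∷ b ∷ c ∷ d ∷ []))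

  -‿cong : ∀ {a b} → a ≋ b → - a ≋ - b
  -‿cong {a} {b} (mod-p p∣a-b) = ∣⇒≋ (∣m⇒∣-m p∣a-b) (solve (a ∷ b ∷ []))

  *-cong : ∀ {a b c d} → a ≋ b → c ≋ d → a * c ≋ b * d
  *-cong {a} {b} {c} {d} (mod-p p∣a-b) (mod-p p∣c-d) =
    ∣⇒≋ (∣m∣n⇒∣m+n (∣n⇒∣m*n a p∣c-d) (∣m⇒∣m*n d p∣a-b)) (solve (a ∷ b ∷ c ∷ d ∷ []))

  +-congˡ : ∀ c {a b} → a ≋ b → c + a ≋ c + b
  +-congˡ c = +-cong (≋-refl {c})

  *-congˡ : ∀ c {a b} → a ≋ b → c * a ≋ c * b
  *-congˡ c = *-cong (≋-refl {c})

  *-congʳ : ∀ c {a b} → a ≋ b → a * c ≋ b * c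
  *-congʳ c a≋b = *-cong a≋b (≋-refl {c})

  ≋-setoid : Setoid 0ℓ 0ℓ
  ≋-setoid = record
    { _≈_ = _≋_
    ; isEquivalence = record { refl = ≋-refl ; sym = ≋-sym ; trans = ≋-trans }
    }

  open import Relation.Binary.Reasoning.Setoid ≋-setoid

  record _≈₄_ (a b : Poly) : Set where
    constructor ⟨_,_,_,_⟩
    field
      coeff₀ : a 0 ≋ b 0
      coeff₁ : a 1 ≋ b 1
      coeff₂ : a 2 ≋ b 2
      coeff₃ : a 3 ≋ b 3

  ≈₄-sym : ∀ {a b} → a ≈₄ b → b ≈₄ a
  ≈₄-sym ⟨ e₀ , e₁ , e₂ , e₃ ⟩ = ⟨ ≋-sym e₀ , ≋-sym e₁ , ≋-sym e₂ , ≋-sym e₃ ⟩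

  ≈₄-trans : ∀ {a b c} → a ≈₄ b → b ≈₄ c → a ≈₄ c
  ≈₄-trans ⟨ e₀ , e₁ , e₂ , e₃ ⟩ ⟨ f₀ , f₁ , f₂ , f₃ ⟩ =
    ⟨ ≋-trans e₀ f₀ , ≋-trans e₁ f₁ , ≋-trans e₂ f₂ , ≋-trans e₃ f₃ ⟩

  ≈₄-jet : ∀ {a} → a ≈₄ jet (a 0) (a 1) (a 2) (a 3)
  ≈₄-jet = ⟨ ≋-refl , ≋-refl , ≋-refl , ≋-refl ⟩

  jet-≡ : ∀ {a₀ a₁ a₂ a₃ b₀ b₁ b₂ b₃} → a₀ ≡ b₀ → a₁ ≡ b₁ → a₂ ≡ b₂ → a₃ ≡ b₃ →
          jet a₀ a₁ a₂ a₃ ≈₄ jet b₀ b₁ b₂ b₃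
  jet-≡ e₀ e₁ e₂ e₃ = ⟨ ≡⇒≋ e₀ , ≡⇒≋ e₁ , ≡⇒≋ e₂ , ≡⇒≋ e₃ ⟩

  ≈[]⇒≈₄ : ∀ {a b} → 4 ≤ p ∸ 1 → a ≈[ p ] b → a ≈₄ b
  ≈[]⇒≈₄ {a} {b} 4≤p-1 a≈b =
    ⟨ at 0 z≤n , at 1 (s≤s z≤n) , at 2 (s≤s (s≤s z≤n)) , at 3 ℕ.≤-refl ⟩
    where
    at : ∀ i → i ≤ 3 → a i ≋ b i
    at i i≤3 = mod-p (∣ᵤ⇒∣ (a≈b i (ℕ.≤-trans (s≤s i≤3) 4≤p-1)))

  ⊗-jet : ∀ {a b a₀ a₁ a₂ a₃ b₀ b₁ b₂ b₃} →
          a ≈₄ jet a₀ a₁ a₂ a₃ → b ≈₄ jet b₀ b₁ b₂ b₃ →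
          a ⊗ b ≈₄ jet (a₀ * b₀) (a₀ * b₁ + a₁ * b₀) (a₀ * b₂ + a₁ * b₁ + a₂ * b₀)
                       (a₀ * b₃ + a₁ * b₂ + a₂ * b₁ + a₃ * b₀)
  ⊗-jet {a} {b} ⟨ a₀ , a₁ , a₂ , a₃ ⟩ ⟨ b₀ , b₁ , b₂ , b₃ ⟩ =
    ⟨ ≋-trans (≡⇒≋ (⊗-coeff₀ a b)) (*-cong a₀ b₀)
    , ≋-trans (≡⇒≋ (⊗-coeff₁ a b)) (+-cong (*-cong a₀ b₁) (*-cong a₁ b₀))
    , ≋-trans (≡⇒≋ (⊗-coeff₂ a b)) (+-cong (+-cong (*-cong a₀ b₂) (*-cong a₁ b₁)) (*-cong a₂ b₀))
    , ≋-trans (≡⇒≋ (⊗-coeff₃ a b))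
        (+-cong (+-cong (+-cong (*-cong a₀ b₃) (*-cong a₁ b₂)) (*-cong a₂ b₁)) (*-cong a₃ b₀))
    ⟩

  jet-inverse : ∀ {b₀ b₁ b₂ b₃ a₁ a₂ a₃} →
    jet (b₀ * + 1) (b₀ * a₁ + b₁ * + 1) (b₀ * a₂ + b₁ * a₁ + b₂ * + 1)
        (b₀ * a₃ + b₁ * a₂ + b₂ * a₁ + b₃ * + 1) ≈₄ 𝟙 →
    jet b₀ b₁ b₂ b₃ ≈₄ jet (+ 1) (- a₁) (a₁ * a₁ - a₂) (+ 2 * a₁ * a₂ - a₁ * a₁ * a₁ - a₃)
  jet-inverse {b₀} {b₁} {b₂} {b₃} {a₁} {a₂} {a₃} ⟨ e₀ , e₁ , e₂ , e₃ ⟩ = ⟨ b₀≋ , b₁≋ , b₂≋ , b₃≋ ⟩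
    where
    b₀≋ : b₀ ≋ + 1
    b₀≋ = ≋-trans (≡⇒≋ (sym (ℤ.*-identityʳ b₀))) e₀

    b₁≋ : b₁ ≋ - a₁
    b₁≋ = begin
      b₁                                  ≡⟨ solve (b₀ ∷ b₁ ∷ a₁ ∷ []) ⟩
      (b₀ * a₁ + b₁ * + 1) - b₀ * a₁      ≈⟨ +-cong e₁ (-‿cong (*-congʳ a₁ b₀≋)) ⟩
      + 0 - + 1 * a₁                      ≡⟨ solve (a₁ ∷ []) ⟩
      - a₁                                ∎

    b₂≋ : b₂ ≋ a₁ * a₁ - a₂
    b₂≋ = begin
      b₂
        ≡⟨ solve (b₀ ∷ b₁ ∷ b₂ ∷ a₁ ∷ a₂ ∷ []) ⟩
      (b₀ * a₂ + b₁ * a₁ + b₂ * + 1) - (b₀ * a₂ + b₁ * a₁)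
        ≈⟨ +-cong e₂ (-‿cong (+-cong (*-congʳ a₂ b₀≋) (*-congʳ a₁ b₁≋))) ⟩
      + 0 - (+ 1 * a₂ + - a₁ * a₁)
        ≡⟨ solve (a₁ ∷ a₂ ∷ []) ⟩
      a₁ * a₁ - a₂
        ∎

    b₃≋ : b₃ ≋ + 2 * a₁ * a₂ - a₁ * a₁ * a₁ - a₃
    b₃≋ = begin
      b₃
        ≡⟨ solve (b₀ ∷ b₁ ∷ b₂ ∷ b₃ ∷ a₁ ∷ a₂ ∷ a₃ ∷ []) ⟩
      (b₀ * a₃ + b₁ * a₂ + b₂ * a₁ + b₃ * + 1) - (b₀ * a₃ + b₁ * a₂ + b₂ * a₁)
        ≈⟨ +-cong e₃ (-‿cong (+-cong (+-cong (*-congʳ a₃ b₀≋) (*-congʳ a₂ b₁≋))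
                                     (*-congʳ a₁ b₂≋))) ⟩
      + 0 - (+ 1 * a₃ + - a₁ * a₂ + (a₁ * a₁ - a₂) * a₁)
        ≡⟨ solve (a₁ ∷ a₂ ∷ a₃ ∷ []) ⟩
      + 2 * a₁ * a₂ - a₁ * a₁ * a₁ - a₃
        ∎

  ⊗-inverse-jet : ∀ {a b a₁ a₂ a₃} → a ≈₄ jet (+ 1) a₁ a₂ a₃ → b ⊗ a ≈₄ 𝟙 →
    b ≈₄ jet (+ 1) (- a₁) (a₁ * a₁ - a₂) (+ 2 * a₁ * a₂ - a₁ * a₁ * a₁ - a₃)
  ⊗-inverse-jet {b = b} a≈ b⊗a≈1 =
    ≈₄-trans (≈₄-jet {b}) (jet-inverse (≈₄-trans (≈₄-sym (⊗-jet (≈₄-jet {b}) a≈)) b⊗a≈1))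

  affine-jet : ∀ {x a a₁ a₂ a₃} → a ≈₄ jet (+ 1) a₁ a₂ a₃ →
    affine x a ≈₄ jet (+ 1) (- ((x - + 1) * a₁)) (- ((x - + 1) * a₂)) (- ((x - + 1) * a₃))
  affine-jet {x} {a} ⟨ e₀ , e₁ , e₂ , e₃ ⟩ = ⟨ coeff₀ , higher e₁ , higher e₂ , higher e₃ ⟩
    where
    scaled : ∀ {i aᵢ} → a i ≋ aᵢ → (const (x - + 1) ⊗ a) i ≋ (x - + 1) * aᵢ
    scaled {i} e = ≋-trans (≡⇒≋ (const-⊗ (x - + 1) a i)) (*-congˡ (x - + 1) e)

    coeff₀ : x - (const (x - + 1) ⊗ a) 0 ≋ + 1
    coeff₀ = begin
      x - (const (x - + 1) ⊗ a) 0  ≈⟨ +-congˡ x (-‿cong (scaled e₀)) ⟩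
      x - (x - + 1) * + 1          ≡⟨ solve (x ∷ []) ⟩
      + 1                          ∎

    higher : ∀ {i aᵢ} → a (suc i) ≋ aᵢ → + 0 - (const (x - + 1) ⊗ a) (suc i) ≋ - ((x - + 1) * aᵢ)
    higher e = ≋-trans (≡⇒≋ (ℤ.+-identityˡ _)) (-‿cong (scaled e))

  -- The binomial series of (1 - λ)^k modulo λ⁴, with the denominators 2 and 6 cleared.
  record PowerJet (c : Poly) (k : ℤ) : Set where
    constructor powerJet
    field
      binomial₀ : c 0 ≋ + 1
      binomial₁ : c 1 ≋ - k
      binomial₂ : + 2 * c 2 ≋ k * (k - + 1)
      binomial₃ : + 6 * c 3 ≋ - (k * (k - + 1) * (k - + 2))

  powerJet-resp : ∀ {c d k} → c ≈₄ d → PowerJet c k → PowerJet d k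
  powerJet-resp ⟨ e₀ , e₁ , e₂ , e₃ ⟩ (powerJet b₀ b₁ b₂ b₃) =
    powerJet (≋-trans (≋-sym e₀) b₀) (≋-trans (≋-sym e₁) b₁)
             (≋-trans (*-congˡ (+ 2) (≋-sym e₂)) b₂) (≋-trans (*-congˡ (+ 6) (≋-sym e₃)) b₃)

  powerJet-𝟙 : PowerJet 𝟙 (+ 0)
  powerJet-𝟙 = powerJet ≋-refl ≋-refl ≋-refl ≋-refl

  powerJet-1-λ : PowerJet oneMinusLam (+ 1)
  powerJet-1-λ = powerJet ≋-refl ≋-refl ≋-refl ≋-refl

  powerJet-[1-λ]⁻¹ : ∀ {a} → a ≈₄ jet (+ 1) (+ 1) (+ 1) (+ 1) → PowerJet a -[1+ 0 ]
  powerJet-[1-λ]⁻¹ a≈ = powerJet-resp (≈₄-sym a≈) (powerJet ≋-refl ≋-refl ≋-refl ≋-refl)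

  powerJet-jet-* : ∀ {a₀ a₁ a₂ a₃ b₀ b₁ b₂ b₃ s t} →
    PowerJet (jet a₀ a₁ a₂ a₃) s → PowerJet (jet b₀ b₁ b₂ b₃) t →
    PowerJet (jet (a₀ * b₀) (a₀ * b₁ + a₁ * b₀) (a₀ * b₂ + a₁ * b₁ + a₂ * b₀)
                  (a₀ * b₃ + a₁ * b₂ + a₂ * b₁ + a₃ * b₀)) (s + t)
  powerJet-jet-* {a₀} {a₁} {a₂} {a₃} {b₀} {b₁} {b₂} {b₃} {s} {t}
                 (powerJet a₀≋ a₁≋ a₂≋ a₃≋) (powerJet b₀≋ b₁≋ b₂≋ b₃≋) =
    powerJet (*-cong a₀≋ b₀≋) c₁ c₂ c₃
    where
    c₁ : a₀ * b₁ + a₁ * b₀ ≋ - (s + t)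
    c₁ = begin
      a₀ * b₁ + a₁ * b₀    ≈⟨ +-cong (*-cong a₀≋ b₁≋) (*-cong a₁≋ b₀≋) ⟩
      + 1 * - t + - s * + 1 ≡⟨ solve (s ∷ t ∷ []) ⟩
      - (s + t)            ∎

    c₂ : + 2 * (a₀ * b₂ + a₁ * b₁ + a₂ * b₀) ≋ (s + t) * (s + t - + 1)
    c₂ = begin
      + 2 * (a₀ * b₂ + a₁ * b₁ + a₂ * b₀)
        ≡⟨ solve (a₀ ∷ a₁ ∷ a₂ ∷ b₀ ∷ b₁ ∷ b₂ ∷ []) ⟩
      a₀ * (+ 2 * b₂) + + 2 * a₁ * b₁ + (+ 2 * a₂) * b₀
        ≈⟨ +-cong (+-cong (*-cong a₀≋ b₂≋) (*-cong (*-congˡ (+ 2) a₁≋) b₁≋)) (*-cong a₂≋ b₀≋) ⟩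
      + 1 * (t * (t - + 1)) + + 2 * - s * - t + s * (s - + 1) * + 1
        ≡⟨ solve (s ∷ t ∷ []) ⟩
      (s + t) * (s + t - + 1)
        ∎

    c₃ : + 6 * (a₀ * b₃ + a₁ * b₂ + a₂ * b₁ + a₃ * b₀) ≋ - ((s + t) * (s + t - + 1) * (s + t - + 2))
    c₃ = begin
      + 6 * (a₀ * b₃ + a₁ * b₂ + a₂ * b₁ + a₃ * b₀)
        ≡⟨ solve (a₀ ∷ a₁ ∷ a₂ ∷ a₃ ∷ b₀ ∷ b₁ ∷ b₂ ∷ b₃ ∷ []) ⟩
      a₀ * (+ 6 * b₃) + + 3 * a₁ * (+ 2 * b₂) + + 3 * (+ 2 * a₂) * b₁ + (+ 6 * a₃) * b₀
        ≈⟨ +-cong (+-cong (+-cong (*-cong a₀≋ b₃≋) (*-cong (*-congˡ (+ 3) a₁≋) b₂≋))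
                          (*-cong (*-congˡ (+ 3) a₂≋) b₁≋))
                  (*-cong a₃≋ b₀≋) ⟩
      + 1 * - (t * (t - + 1) * (t - + 2)) + + 3 * - s * (t * (t - + 1))
        + + 3 * (s * (s - + 1)) * - t + - (s * (s - + 1) * (s - + 2)) * + 1
        ≡⟨ solve (s ∷ t ∷ []) ⟩
      - ((s + t) * (s + t - + 1) * (s + t - + 2))
        ∎

  powerJet-⊗ : ∀ {a b s t} → PowerJet a s → PowerJet b t → PowerJet (a ⊗ b) (s + t)
  powerJet-⊗ {a} {b} pa pb =
    powerJet-resp (≈₄-sym (⊗-jet (≈₄-jet {a}) (≈₄-jet {b})))
                  (powerJet-jet-* (powerJet-resp ≈₄-jet pa) (powerJet-resp ≈₄-jet pb))

  powerJet-^ : ∀ {a k} → PowerJet a k → ∀ n → PowerJet (a ^ n) (+ n * k)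
  powerJet-^ pa zero = powerJet-𝟙
  powerJet-^ {a} {k} pa (suc n) =
    subst (PowerJet (a ^ suc n)) (sym (ℤ.suc-* (+ n) k)) (powerJet-⊗ pa (powerJet-^ pa n))

  powerJet-zpow : ∀ {a ainv} → PowerJet a (+ 1) → PowerJet ainv -[1+ 0 ] →
                  ∀ k → PowerJet (zpow a ainv k) k
  powerJet-zpow {a} pa _ (+ n) =
    subst (PowerJet (a ^ n)) (ℤ.*-identityʳ (+ n)) (powerJet-^ pa n)
  powerJet-zpow {ainv = ainv} _ painv -[1+ n ] =
    subst (PowerJet (ainv ^ suc n)) (trans (ℤ.*-comm (+ suc n) -[1+ 0 ]) (ℤ.-1*i≡-i (+ suc n)))
          (powerJet-^ painv (suc n))

  powerJet-cubic : ∀ {c k t} → PowerJet c k → c 1 ≋ t → + 6 * c 3 ≋ t * (t + + 1) * (t + + 2)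
  powerJet-cubic {c} {k} {t} (powerJet _ c₁≋-k _ c₃≋) c₁≋t = begin
    + 6 * c 3                       ≈⟨ c₃≋ ⟩
    - (k * (k - + 1) * (k - + 2))   ≡⟨ solve (k ∷ []) ⟩
    - k * (- k + + 1) * (- k + + 2) ≈⟨ *-cong (*-cong -k≋t (+-cong -k≋t ≋-refl)) (+-cong -k≋t ≋-refl) ⟩
    t * (t + + 1) * (t + + 2)       ∎
    where
    -k≋t : - k ≋ t
    -k≋t = ≋-trans (≋-sym c₁≋-k) c₁≋t

  ≋0⇒∣ : ∀ {a} → a ≋ + 0 → + p ∣ a
  ≋0⇒∣ {a} (mod-p p∣a-0) = ∣⇒∣ᵤ (subst (+ p Signed.∣_) (ℤ.+-identityʳ a) p∣a-0)

  powerJet-obstruction : ∀ {c k c₂} x → PowerJet c k →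
    c ≈₄ jet (+ 1) (+ 2 * (x - + 1)) c₂ ((x - + 1) * x * (+ 2 * x - + 1)) →
    + 2 * ((x - + 1) * x * (+ 2 * x - + 1)) ≋ + 0
  powerJet-obstruction {c} x c-powerJet ⟨ _ , c₁≋ , _ , c₃≋ ⟩ =
    let t = + 2 * (x - + 1) in begin
    + 2 * ((x - + 1) * x * (+ 2 * x - + 1))
      ≡⟨ solve (x ∷ []) ⟩
    + 6 * ((x - + 1) * x * (+ 2 * x - + 1)) - t * (t + + 1) * (t + + 2)
      ≈⟨ +-cong (*-congˡ (+ 6) (≋-sym c₃≋)) ≋-refl ⟩
    + 6 * c 3 - t * (t + + 1) * (t + + 2)
      ≈⟨ +-cong (powerJet-cubic c-powerJet c₁≋) ≋-refl ⟩
    t * (t + + 1) * (t + + 2) - t * (t + + 1) * (t + + 2)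
      ≡⟨ ℤ.+-inverseʳ (t * (t + + 1) * (t + + 2)) ⟩
    + 0
      ∎

  1-λ-jet : oneMinusLam ≈₄ jet (+ 1) -[1+ 0 ] (+ 0) (+ 0)
  1-λ-jet = ≈₄-jet

  z′-jet : ∀ x {inv winv} → inv ≈₄ jet (+ 1) (+ 1) (+ 1) (+ 1) → winv ⊗ affine x inv ≈₄ 𝟙 →
    affine x oneMinusLam ⊗ winv ≈₄
      jet (+ 1) (+ 2 * (x - + 1)) ((x - + 1) * (+ 2 * x - + 1)) ((x - + 1) * x * (+ 2 * x - + 1))
  z′-jet x {inv} {winv} inv≈ winv-inverse =
    ≈₄-trans (⊗-jet w≈ winv≈) (jet-≡ refl (solve (x ∷ [])) (solve (x ∷ [])) (solve (x ∷ [])))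
    where
    w≈ : affine x oneMinusLam ≈₄ jet (+ 1) (x - + 1) (+ 0) (+ 0)
    w≈ = ≈₄-trans (affine-jet 1-λ-jet) (jet-≡ refl (solve (x ∷ [])) (solve (x ∷ [])) (solve (x ∷ [])))

    σw≈ : affine x inv ≈₄ jet (+ 1) (+ 1 - x) (+ 1 - x) (+ 1 - x)
    σw≈ = ≈₄-trans (affine-jet inv≈) (jet-≡ refl (solve (x ∷ [])) (solve (x ∷ [])) (solve (x ∷ [])))

    winv≈ : winv ≈₄ jet (+ 1) (x - + 1) ((x - + 1) * x) ((x - + 1) * x * x)
    winv≈ = ≈₄-trans (⊗-inverse-jet σw≈ winv-inverse)
                     (jet-≡ refl (solve (x ∷ [])) (solve (x ∷ [])) (solve (x ∷ [])))

prime∤* : ∀ {p} → Prime p → ∀ a b → ¬ (+ p ∣ a) → ¬ (+ p ∣ b) → ¬ (+ p ∣ a * b)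
prime∤* {p} p-prime a b p∤a p∤b p∣ab =
  [ p∤a , p∤b ]′ (euclidsLemma ∣ a ∣ ∣ b ∣ p-prime (subst (p ∣ℕ_) (ℤ.abs-* a b) p∣ab))

odd-prime≡3⊎≥5 : ∀ {p} → Prime p → p ≢ 2 → p ≡ 3 ⊎ 5 ≤ p
odd-prime≡3⊎≥5 {0} p-prime _ = ⊥-elim (¬prime[0] p-prime)
odd-prime≡3⊎≥5 {1} p-prime _ = ⊥-elim (¬prime[1] p-prime)
odd-prime≡3⊎≥5 {2} _ p≢2 = ⊥-elim (p≢2 refl)
odd-prime≡3⊎≥5 {3} _ _ = inj₁ refl
odd-prime≡3⊎≥5 {4} p-prime _ = ⊥-elim (toWitnessFalse {a? = prime? 4} _ p-prime)
odd-prime≡3⊎≥5 {suc (suc (suc (suc (suc n))))} _ _ = inj₂ (ℕ.m≤m+n 5 n)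

3∣x⊎3∣x-1⊎3∣2x-1 : ∀ x → (+ 3 ∣ x) ⊎ (+ 3 ∣ x - + 1) ⊎ (+ 3 ∣ + 2 * x - + 1)
3∣x⊎3∣x-1⊎3∣2x-1 x = by-residue (x % + 3) (x / + 3) (n%d<d x (+ 3)) (a≡a%n+[a/n]*n x (+ 3))
  where
  3∣ : ∀ {z} q → z ≡ q * + 3 → + 3 ∣ z
  3∣ q z≡3q = ∣⇒∣ᵤ (divides q z≡3q)

  by-residue : ∀ r q → r < 3 → x ≡ + r + q * + 3 →
               (+ 3 ∣ x) ⊎ (+ 3 ∣ x - + 1) ⊎ (+ 3 ∣ + 2 * x - + 1)
  by-residue 0 q _ x≡3q = inj₁ (3∣ q (trans x≡3q (ℤ.+-identityˡ (q * + 3))))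
  by-residue 1 q _ x≡1+3q = inj₂ (inj₁ (3∣ q (trans (cong (_- + 1) x≡1+3q) (solve (q ∷ [])))))
  by-residue 2 q _ x≡2+3q =
    inj₂ (inj₂ (3∣ (+ 1 + + 2 * q) (trans (cong (λ y → + 2 * y - + 1) x≡2+3q) (solve (q ∷ [])))))
  by-residue (suc (suc (suc _))) _ (s≤s (s≤s (s≤s ()))) _

proposition47 : (p : ℕ) → Prime p → p ≢ 2 →
    (x : ℤ) → ¬ ((+ p) ∣ x) → ¬ ((+ p) ∣ (x - + 1)) → ¬ ((+ p) ∣ ((+ 2) * x - + 1)) →
    (inv : Poly) → inv ⊗ oneMinusLam ≈[ p ] 𝟙 →
    (winv : Poly) → winv ⊗ (const x ⊖ const (x - + 1) ⊗ inv) ≈[ p ] 𝟙 →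
    (k : ℤ) →
    ¬ ((const x ⊖ const (x - + 1) ⊗ oneMinusLam) ⊗ winv ≈[ p ] zpow oneMinusLam inv k)
proposition47 p p-prime p≢2 x p∤x p∤x-1 p∤2x-1 inv inv-inverse winv winv-inverse k z′≈c
  with odd-prime≡3⊎≥5 p-prime p≢2
... | inj₁ refl = [ p∤x , [ p∤x-1 , p∤2x-1 ]′ ]′ (3∣x⊎3∣x-1⊎3∣2x-1 x)
... | inj₂ 5≤p = p∤2x[x-1][2x-1] (≋0⇒∣ (powerJet-obstruction x z′-powerJet z′≈jet))
  where
  open Modulo p

  truncate : ∀ {a b} → a ≈[ p ] b → a ≈₄ b
  truncate = ≈[]⇒≈₄ (ℕ.∸-monoˡ-≤ 1 5≤p)

  inv≈ : inv ≈₄ jet (+ 1) (+ 1) (+ 1) (+ 1)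
  inv≈ = ⊗-inverse-jet 1-λ-jet (truncate inv-inverse)

  z′-powerJet : PowerJet (zpow oneMinusLam inv k) k
  z′-powerJet = powerJet-zpow powerJet-1-λ (powerJet-[1-λ]⁻¹ inv≈) k

  z′≈jet : zpow oneMinusLam inv k ≈₄
    jet (+ 1) (+ 2 * (x - + 1)) ((x - + 1) * (+ 2 * x - + 1)) ((x - + 1) * x * (+ 2 * x - + 1))
  z′≈jet = ≈₄-trans (≈₄-sym (truncate z′≈c)) (z′-jet x {winv = winv} inv≈ (truncate winv-inverse))

  p∤2 : ¬ (+ p ∣ + 2)
  p∤2 p∣2 = contradiction (ℕ.≤-trans 5≤p (p ≤ 2 ∋ ∣⇒≤ p∣2)) λ { (s≤s (s≤s ())) }

  p∤2x[x-1][2x-1] : ¬ (+ p ∣ + 2 * ((x - + 1) * x * (+ 2 * x - + 1)))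
  p∤2x[x-1][2x-1] =
    prime∤* p-prime (+ 2) ((x - + 1) * x * (+ 2 * x - + 1)) p∤2
      (prime∤* p-prime ((x - + 1) * x) (+ 2 * x - + 1)
        (prime∤* p-prime (x - + 1) x p∤x-1 p∤x) p∤2x-1)
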